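{- For every logic $\mathsf{L}^\star$ as described in the context and every constant specification $\mathsf{CS}$, $\mathsf{L}^\star_{\mathsf{CS}}\nvdash\bot$.
   Context: Terms: $t::=c_i\mid x_i\mid \mathsf{c}^\star\mid (t+t)\mid\ !t$ ($c_i$ constants, $x_i$ variables, $\mathsf{c}^\star$ a special constant). Formulas: $F::=p_i\mid\bot\mid F\to F\mid t:F$. The $\mathsf{c}^\star$-terms: $\mathsf{c}^\star$ is one, and if $c$ is one and $s,t$ are any terms then $s+c$ and $c+t$ are. Axiom schemes: (cl) all axioms of classical propositional logic; (j+) $s:A\lor t:A\to(s+t):A$; (jc$^\star$) $c:A\land c:(A\to B)\to c:B$ for $\mathsf{c}^\star$-terms $c$; (j4) $t:A\to\ !t:(t:A)$; (jd) $t:\bot\to\bot$; (jt) $t:A\to A$. A logic $\mathsf{L}^\star$ consists of (cl),(j+),(jc$^\star$) and some subset of $\{$(j4),(jd),(jt)$\}$. A constant specification $\mathsf{CS}$ is a set of pairs $(c,A)$, $c$ a constant, $A$ an axiom of $\mathsf{L}^\star$. $\mathsf{L}^\star_{\mathsf{CS}}$ is the Hilbert system with these axioms and rules modus ponens and axiom necessitation: for $(c,A)\in\mathsf{CS}$ and $n\ge0$ infer $!^nc:\,!^{n-1}c:\cdots:\,!c:c:A$. -}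

module Defs where

open import Data.Nat using (ℕ; zero; suc)
open import Data.Bool using (Bool; true; false; if_then_else_)
open import Relation.Binary.PropositionalEquality using (_≡_)

data Tm : Set where
  const : ℕ → Tm
  var   : ℕ → Tm
  cstar : Tm
  _⊕_   : Tm → Tm → Tm
  !_    : Tm → Tm

data Fm : Set where
  prop : ℕ → Fm
  falsum : Fm
  _⇒_ : Fm → Fm → Fm
  _∶_ : Tm → Fm → Fm

infixr 5 _⇒_
infix 6 _∶_

¬ᶠ_ : Fm → Fm
¬ᶠ A = A ⇒ falsum

_∨ᶠ_ : Fm → Fm → Fm
A ∨ᶠ B = (¬ᶠ A) ⇒ B

_∧ᶠ_ : Fm → Fm → Fm
A ∧ᶠ B = ¬ᶠ (A ⇒ ¬ᶠ B)

data IsCStar : Tm → Set where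
  cs-base : IsCStar cstar
  cs-right : ∀ {s c} → IsCStar c → IsCStar (s ⊕ c)
  cs-left  : ∀ {c t} → IsCStar c → IsCStar (c ⊕ t)

-- Classical propositional tautologies: formulas true under every Boolean
-- valuation treating propositional letters p_i and justification
-- formulas t : F as atoms.
eval : (ℕ → Bool) → (Tm → Fm → Bool) → Fm → Bool
eval vp vj (prop i) = vp i
eval vp vj falsum = false
eval vp vj (A ⇒ B) = if eval vp vj A then eval vp vj B else true
eval vp vj (t ∶ A) = vj t A

Tautology : Fm → Set
Tautology A = ∀ (vp : ℕ → Bool) (vj : Tm → Fm → Bool) → eval vp vj A ≡ true

record Logic : Set where
  field
    hasJ4 : Bool
    hasJD : Bool
    hasJT : Bool
open Logic public

data Axiom (L : Logic) : Fm → Set where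
  cl   : ∀ {A} → Tautology A → Axiom L A
  j+   : ∀ s t A → Axiom L ((s ∶ A) ∨ᶠ (t ∶ A) ⇒ ((s ⊕ t) ∶ A))
  jc⋆  : ∀ {c} → IsCStar c → ∀ A B →
         Axiom L ((c ∶ A) ∧ᶠ (c ∶ (A ⇒ B)) ⇒ (c ∶ B))
  j4   : hasJ4 L ≡ true → ∀ t A → Axiom L ((t ∶ A) ⇒ ((! t) ∶ (t ∶ A)))
  jd   : hasJD L ≡ true → ∀ t → Axiom L ((t ∶ falsum) ⇒ falsum)
  jt   : hasJT L ≡ true → ∀ t A → Axiom L ((t ∶ A) ⇒ A)

record ConstSpec (L : Logic) : Set₁ where
  field
    member : ℕ → Fm → Set
    isAxiom : ∀ c A → member c A → Axiom L A
open ConstSpec public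

bangs : ℕ → Tm → Tm
bangs zero t = t
bangs (suc n) t = ! (bangs n t)

necFm : ℕ → ℕ → Fm → Fm
necFm zero c A = const c ∶ A
necFm (suc n) c A = bangs (suc n) (const c) ∶ necFm n c A

data _,_⊢_ (L : Logic) (CS : ConstSpec L) : Fm → Set where
  ax  : ∀ {A} → Axiom L A → L , CS ⊢ A
  mp  : ∀ {A B} → L , CS ⊢ (A ⇒ B) → L , CS ⊢ A → L , CS ⊢ B
  an  : ∀ {c A} → member CS c A → (n : ℕ) → L , CS ⊢ necFm n c A

infix 2 _,_⊢_

-- Read every justification formula t : A as plain A and every propositional
-- letter as false.  This forgetful Boolean semantics validates all axioms
-- (each becomes a tautology or an instance of A → A), is preserved by modus
-- ponens, and is unaffected by the prefix of axiom necessitation; but it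
-- makes ⊥ false.
module Submission where

open import Data.Bool using (Bool; true; false; if_then_else_)
open import Data.Nat using (ℕ; zero; suc)
open import Relation.Binary.PropositionalEquality using (_≡_; refl; trans; sym)
open import Relation.Nullary using (¬_)

open import Defs

forget : Fm → Bool
forget (prop i) = false
forget falsum   = false
forget (A ⇒ B)  = if forget A then forget B else true
forget (t ∶ A)  = forget A

Valid : Fm → Set
Valid A = forget A ≡ true

eval-forget : ∀ A → eval (λ _ → false) (λ _ → forget) A ≡ forget A
eval-forget (prop i) = refl
eval-forget falsum   = refl
eval-forget (A ⇒ B) rewrite eval-forget A | eval-forget B = refl
eval-forget (t ∶ A)  = refl

tautology-valid : ∀ A → Tautology A → Valid A
tautology-valid A taut = trans (sym (eval-forget A)) (taut (λ _ → false) (λ _ → forget))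

⇒-refl-valid : ∀ A → Valid (A ⇒ A)
⇒-refl-valid A with forget A
... | true  = refl
... | false = refl

mp-valid : ∀ A B → Valid (A ⇒ B) → Valid A → Valid B
mp-valid A B A⇒B-valid A-valid rewrite A-valid = A⇒B-valid

necFm-valid : ∀ n c A → Valid A → Valid (necFm n c A)
necFm-valid zero    c A A-valid = A-valid
necFm-valid (suc n) c A A-valid = necFm-valid n c A A-valid

axiom-valid : ∀ {L A} → Axiom L A → Valid A
axiom-valid (cl {A} taut) = tautology-valid A taut
axiom-valid (j+ s t A)    with forget A
... | true  = refl
... | false = refl
axiom-valid (jc⋆ _ A B)   with forget A | forget B
... | true  | true  = refl
... | true  | false = refl
... | false | _     = refl
axiom-valid (j4 _ t A)    = ⇒-refl-valid A
axiom-valid (jd _ t)      = refl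
axiom-valid (jt _ t A)    = ⇒-refl-valid A

derivable-valid : ∀ {L CS A} → L , CS ⊢ A → Valid A
derivable-valid (ax a)           = axiom-valid a
derivable-valid (mp {A} {B} d e) = mp-valid A B (derivable-valid d) (derivable-valid e)
derivable-valid {CS = CS} (an {c} {A} m n) = necFm-valid n c A (axiom-valid (isAxiom CS c A m))

mainTheorem4 : (L : Logic) (CS : ConstSpec L) → ¬ (L , CS ⊢ falsum)
mainTheorem4 L CS d with derivable-valid d
... | ()
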